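{- Let $\Psi$ be an LTL$_f$+ (resp. PPLTL+) formula over a finite set $AP$ of propositions given as a positive Boolean combination (using $\land,\lor$) of $k$ atoms $\mathbb{Q}_1\Phi_1,\ldots,\mathbb{Q}_k\Phi_k$, where $\mathbb{Q}_i\in\{\exists,\forall,\forall\exists,\exists\forall\}$ and each $\Phi_i$ is an LTL$_f$ (resp. PPLTL) formula. For each $i\in[k]$ let $(D_i,F_i)$, $D_i=(2^{AP},Q_i,\iota_i,\delta_i)$, be a DFA accepting exactly the finite traces satisfying $\Phi_i$, with $\iota_i$ having no incoming transitions; if $\mathbb{Q}_i=\forall$ add $\iota_i$ to $F_i$, if $\mathbb{Q}_i=\exists$ remove $\iota_i$ from $F_i$. Let $D'_\Psi$ be the product deterministic transition system with states $Q_1\times\cdots\times Q_k$, initial state $(\iota_1,\ldots,\iota_k)$ and componentwise transitions. Let $O'=([k],\gamma,\varphi)$ with $\gamma(q_1,\ldots,q_k)=\{i\in[k]\mid q_i\in F_i\}$ and $\varphi$ obtained from $\Psi$ by replacing each atom $\mathbb{Q}_i\Phi_i$ by $\mathsf{F}\,i$ if $\mathbb{Q}_i=\exists$, $\mathsf{G}\,i$ if $\mathbb{Q}_i=\forall$, $\mathsf{GF}\,i$ if $\mathbb{Q}_i=\forall\exists$, and $\mathsf{FG}\,i$ if $\mathbb{Q}_i=\exists\forall$. Then the Manna-Pnueli automaton $\mathcal{A}'_\Psi=(D'_\Psi,O')$ is equivalent to $\Psi$, i.e. $L(\mathcal{A}'_\Psi)=[\Psi]$.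
   Context: LTL$_f$+/PPLTL+ semantics over infinite traces: $[\Psi\lor\Psi']=[\Psi]\cup[\Psi']$, $[\Psi\land\Psi']=[\Psi]\cap[\Psi']$, $[\mathbb{Q}\Phi]=\mathbb{Q}[\Phi]$, where for a set $T$ of finite traces, $\exists T$ (resp. $\forall T$) is the set of infinite traces with at least one (resp. all) finite nonempty prefixes in $T$, and $\forall\exists T$ (resp. $\exists\forall T$) those with infinitely many (resp. all but finitely many) prefixes in $T$. A Manna-Pnueli (MP) formula over events $\Gamma$ is a positive Boolean formula over atoms $\mathsf{GF}\,a,\mathsf{FG}\,a,\mathsf{F}\,a,\mathsf{G}\,a$ ($a\in\Gamma$); for a labeling $\gamma$ and state sequence $q_0q_1\ldots$, $\mathsf{F}\,a$ holds iff $a\in\gamma(q_j)$ for some $j$, $\mathsf{G}\,a$ iff for all $j$, $\mathsf{GF}\,a$ iff for infinitely many $j$, $\mathsf{FG}\,a$ iff for all but finitely many $j$. The MP automaton $(D,O)$ with $D$ deterministic accepts an infinite word iff its run $q_0q_1\ldots$ (with $q_0$ initial) satisfies the MP formula. -}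

module Defs where

open import Data.Nat using (ℕ; zero; suc; _≤_; _<_)
open import Data.Fin using (Fin; toℕ; fromℕ; _≟_)
open import Data.Bool using (Bool; true; false; if_then_else_)
open import Data.Vec using (Vec; []; _∷_; lookup; tabulate)
open import Data.Product using (Σ; _×_; _,_; proj₁; proj₂)
open import Data.Sum using (_⊎_)
open import Relation.Nullary using (¬_; does)
open import Relation.Binary.PropositionalEquality using (_≡_; _≢_)

Letter : ℕ → Set
Letter n = Fin n → Bool          -- a subset of AP

FinTrace : ℕ → Set
FinTrace n = Σ ℕ λ m → Vec (Letter n) (suc m)

InfTrace : ℕ → Set
InfTrace n = ℕ → Letter n

-- the finite nonempty prefix of length (suc j)
prefix : ∀ {n} → InfTrace n → ℕ → FinTrace n
prefix w j = j , tabulate (λ i → w (toℕ i))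

-- LTLf (future, evaluated at the first position)

data LTLf (n : ℕ) : Set where
  prop  : Fin n → LTLf n
  not   : LTLf n → LTLf n
  and   : LTLf n → LTLf n → LTLf n
  next  : LTLf n → LTLf n            -- strong next X
  until : LTLf n → LTLf n → LTLf n

holdsL : ∀ {n m} → Vec (Letter n) (suc m) → Fin (suc m) → LTLf n → Set
holdsL t i (prop p) = lookup t i p ≡ true
holdsL t i (not φ) = ¬ holdsL t i φ
holdsL t i (and φ ψ) = holdsL t i φ × holdsL t i ψ
holdsL {m = m} t i (next φ) =
  Σ (Fin (suc m)) λ j → (toℕ j ≡ suc (toℕ i)) × holdsL t j φ
holdsL {m = m} t i (until φ ψ) =
  Σ (Fin (suc m)) λ j → (toℕ i ≤ toℕ j) × holdsL t j ψ ×
    ((l : Fin (suc m)) → toℕ i ≤ toℕ l → toℕ l < toℕ j → holdsL t l φ)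

-- PPLTL (pure past, evaluated at the last position)

data PPLTL (n : ℕ) : Set where
  prop      : Fin n → PPLTL n
  not       : PPLTL n → PPLTL n
  and       : PPLTL n → PPLTL n → PPLTL n
  yesterday : PPLTL n → PPLTL n
  since     : PPLTL n → PPLTL n → PPLTL n

holdsP : ∀ {n m} → Vec (Letter n) (suc m) → Fin (suc m) → PPLTL n → Set
holdsP t i (prop p) = lookup t i p ≡ true
holdsP t i (not φ) = ¬ holdsP t i φ
holdsP t i (and φ ψ) = holdsP t i φ × holdsP t i ψ
holdsP {m = m} t i (yesterday φ) =
  Σ (Fin (suc m)) λ j → (suc (toℕ j) ≡ toℕ i) × holdsP t j φ
holdsP {m = m} t i (since φ ψ) =
  Σ (Fin (suc m)) λ j → (toℕ j ≤ toℕ i) × holdsP t j ψ ×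
    ((l : Fin (suc m)) → toℕ j < toℕ l → toℕ l ≤ toℕ i → holdsP t l φ)

data Logic : Set where
  ltlf ppltl : Logic

Formula : Logic → ℕ → Set
Formula ltlf n = LTLf n
Formula ppltl n = PPLTL n

_⊨_ : ∀ {L n} → FinTrace n → Formula L n → Set
_⊨_ {ltlf} (m , t) φ = holdsL t zero' φ where
  zero' : Fin (suc m)
  zero' = Fin.zero
_⊨_ {ppltl} (m , t) φ = holdsP t (fromℕ m) φ

data PosBool (A : Set) : Set where
  leaf : A → PosBool A
  conj : PosBool A → PosBool A → PosBool A
  disj : PosBool A → PosBool A → PosBool A

evalPB : ∀ {A : Set} → (A → Set) → PosBool A → Set
evalPB v (leaf a) = v a
evalPB v (conj x y) = evalPB v x × evalPB v y
evalPB v (disj x y) = evalPB v x ⊎ evalPB v y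

mapPB : ∀ {A B : Set} → (A → B) → PosBool A → PosBool B
mapPB f (leaf a) = leaf (f a)
mapPB f (conj x y) = conj (mapPB f x) (mapPB f y)
mapPB f (disj x y) = disj (mapPB f x) (mapPB f y)

data Quant : Set where
  ex all allEx exAll : Quant

semQ : ∀ {n} → Quant → (FinTrace n → Set) → InfTrace n → Set
semQ ex    T w = Σ ℕ λ j → T (prefix w j)
semQ all   T w = (j : ℕ) → T (prefix w j)
semQ allEx T w = (i : ℕ) → Σ ℕ λ j → (i ≤ j) × T (prefix w j)
semQ exAll T w = Σ ℕ λ i → (j : ℕ) → i ≤ j → T (prefix w j)

⟦_⟧⁺ : ∀ {L n k} → PosBool (Fin k) → (Fin k → Quant) → (Fin k → Formula L n) →
       InfTrace n → Set
⟦ Ψ ⟧⁺ Q Φ w = evalPB (λ i → semQ (Q i) (λ t → t ⊨ Φ i) w) Ψ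

record DFA (n : ℕ) : Set where
  field
    size  : ℕ
    init  : Fin size
    δ     : Fin size → Letter n → Fin size
    final : Fin size → Bool
open DFA public

runDFA : ∀ {n m} (D : DFA n) → Fin (size D) → Vec (Letter n) m → Fin (size D)
runDFA D q [] = q
runDFA D q (a ∷ v) = runDFA D (δ D q a) v

acceptsDFA : ∀ {n} → DFA n → FinTrace n → Set
acceptsDFA D (m , t) = final D (runDFA D (init D) t) ≡ true

NoIncoming : ∀ {n} → DFA n → Set
NoIncoming D = ∀ q a → δ D q a ≢ init D

Recognizes : ∀ {L n} → DFA n → Formula L n → Set
Recognizes D Φ = ∀ t → (acceptsDFA D t → t ⊨ Φ) × (t ⊨ Φ → acceptsDFA D t)

adjFinal : ∀ {n} → Quant → (D : DFA n) → Fin (size D) → Bool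
adjFinal ex  D q = if does (q ≟ init D) then false else final D q
adjFinal all D q = if does (q ≟ init D) then true else final D q
adjFinal allEx D q = final D q
adjFinal exAll D q = final D q

record DTS (n : ℕ) : Set₁ where
  field
    State    : Set
    initS    : State
    step     : State → Letter n → State
open DTS public

runDTS : ∀ {n} (D : DTS n) → InfTrace n → ℕ → State D
runDTS D w zero = initS D
runDTS D w (suc j) = step D (runDTS D w j) (w j)

data MPKind : Set where
  F G GF FG : MPKind

MPFormula : Set → Set
MPFormula Γ = PosBool (MPKind × Γ)

holdsMP : MPKind → (ℕ → Set) → Set
holdsMP F  P = Σ ℕ λ j → P j
holdsMP G  P = (j : ℕ) → P j
holdsMP GF P = (i : ℕ) → Σ ℕ λ j → (i ≤ j) × P j
holdsMP FG P = Σ ℕ λ i → (j : ℕ) → i ≤ j → P j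

record MPAutomaton (n : ℕ) : Set₁ where
  field
    dts    : DTS n
    Γ      : Set
    label  : State dts → Γ → Bool
    φ      : MPFormula Γ
open MPAutomaton public

acceptsMP : ∀ {n} → MPAutomaton n → InfTrace n → Set
acceptsMP A w = evalPB
  (λ ka → holdsMP (proj₁ ka) (λ j → label A (runDTS (dts A) w j) (proj₂ ka) ≡ true))
  (φ A)

productDTS : ∀ {n k} → (Fin k → DFA n) → DTS n
productDTS {k = k} D = record
  { State = (i : Fin k) → Fin (size (D i))
  ; initS = λ i → init (D i)
  ; step  = λ q a i → δ (D i) (q i) a
  }

kindOf : Quant → MPKind
kindOf ex = F
kindOf all = G
kindOf allEx = GF
kindOf exAll = FG

A′ : ∀ {n k} → PosBool (Fin k) → (Fin k → Quant) → (Fin k → DFA n) → MPAutomaton n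
A′ {k = k} Ψ Q D = record
  { dts   = productDTS D
  ; Γ     = Fin k
  ; label = λ q i → adjFinal (Q i) (D i) (q i)
  ; φ     = mapPB (λ i → kindOf (Q i) , i) Ψ
  }

-- Component i of the product state after j + 1 letters is the state D_i reaches on the prefix of
-- length j + 1, and it is never ι_i; there the adjusted final states agree with F_i, so the label
-- i ∈ γ at time j + 1 holds exactly when that prefix satisfies Φ_i. Only time 0 differs between the
-- run and the sequence of prefixes, and the adjustment of F_i at ι_i makes time 0 neutral: it never
-- witnesses F i (ι_i ∉ F_i for ∃) and never refutes G i (ι_i ∈ F_i for ∀), while GF i and FG i
-- ignore any finite initial segment.
module Submission where

open import Defs
open import Data.Nat using (ℕ; zero; suc; s≤s)
open import Data.Nat.Properties using (m≤n⇒m≤1+n)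
open import Data.Fin using (Fin; toℕ; _≟_)
open import Data.Bool using (true)
open import Data.Vec using (tabulate)
open import Data.Product using (_×_; _,_; proj₂)
open import Data.Product.Function.NonDependent.Propositional using (_×-⇔_)
open import Data.Sum.Function.Propositional using (_⊎-⇔_)
open import Data.Unit using (⊤; tt)
open import Data.Empty using (⊥-elim)
open import Function using (_∘_)
open import Function.Bundles using (_⇔_; mk⇔; Equivalence)
import Function.Properties.Equivalence as ⇔
open import Function.Related.Propositional using (module EquationalReasoning)
open import Relation.Nullary using (¬_; yes; no)
open import Relation.Binary.PropositionalEquality
  using (_≡_; _≢_; refl; sym; cong; subst; module ≡-Reasoning)

evalPB-mapPB : ∀ {A B : Set} {u : A → Set} {v : B → Set} {f : A → B} →
  (∀ a → v (f a) ⇔ u a) → ∀ Ψ → evalPB v (mapPB f Ψ) ⇔ evalPB u Ψ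
evalPB-mapPB v∘f⇔u (leaf a)   = v∘f⇔u a
evalPB-mapPB v∘f⇔u (conj x y) = evalPB-mapPB v∘f⇔u x ×-⇔ evalPB-mapPB v∘f⇔u y
evalPB-mapPB v∘f⇔u (disj x y) = evalPB-mapPB v∘f⇔u x ⊎-⇔ evalPB-mapPB v∘f⇔u y

holdsMP-mono : ∀ κ {P R : ℕ → Set} → (∀ j → P j → R j) → holdsMP κ P → holdsMP κ R
holdsMP-mono F  P⇒R (j , p) = j , P⇒R j p
holdsMP-mono G  P⇒R p j     = P⇒R j (p j)
holdsMP-mono GF P⇒R p i     = let j , i≤j , pj = p i in j , i≤j , P⇒R j pj
holdsMP-mono FG P⇒R (i , p) = i , λ j i≤j → P⇒R j (p j i≤j)

holdsMP-cong : ∀ κ {P R : ℕ → Set} → (∀ j → P j ⇔ R j) → holdsMP κ P ⇔ holdsMP κ R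
holdsMP-cong κ P⇔R =
  mk⇔ (holdsMP-mono κ (Equivalence.to ∘ P⇔R)) (holdsMP-mono κ (Equivalence.from ∘ P⇔R))

-- The condition on the value at time 0 under which it can be dropped without changing κ.
HeadNeutral : MPKind → Set → Set
HeadNeutral F  p = ¬ p
HeadNeutral G  p = p
HeadNeutral GF p = ⊤
HeadNeutral FG p = ⊤

holdsMP-tail : ∀ κ (P : ℕ → Set) → HeadNeutral κ (P 0) → holdsMP κ P ⇔ holdsMP κ (P ∘ suc)
holdsMP-tail F P ¬P0 = mk⇔ drop (λ { (j , p) → suc j , p })
  where
  drop : holdsMP F P → holdsMP F (P ∘ suc)
  drop (zero  , p) = ⊥-elim (¬P0 p)
  drop (suc j , p) = j , p
holdsMP-tail G P P0 = mk⇔ (λ p → p ∘ suc) (λ { p zero → P0 ; p (suc j) → p j })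
holdsMP-tail GF P _ = mk⇔ drop (λ p i → let j , i≤j , pj = p i in suc j , m≤n⇒m≤1+n i≤j , pj)
  where
  drop : holdsMP GF P → holdsMP GF (P ∘ suc)
  drop p i with p (suc i)
  ... | suc j , s≤s i≤j , pj = j , i≤j , pj
holdsMP-tail FG P _ =
  mk⇔ (λ { (i , p) → i , λ j i≤j → p (suc j) (m≤n⇒m≤1+n i≤j) })
      (λ { (i , p) → suc i , λ { (suc j) (s≤s i≤j) → p j i≤j } })

semQ⇔holdsMP : ∀ {n} q (T : FinTrace n → Set) w → semQ q T w ⇔ holdsMP (kindOf q) (T ∘ prefix w)
semQ⇔holdsMP ex    T w = ⇔.refl
semQ⇔holdsMP all   T w = ⇔.refl
semQ⇔holdsMP allEx T w = ⇔.refl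
semQ⇔holdsMP exAll T w = ⇔.refl

adjFinal-≢init : ∀ {n} Q (D : DFA n) {s} → s ≢ init D → adjFinal Q D s ≡ final D s
adjFinal-≢init ex D {s} s≢ι with s ≟ init D
... | yes s≡ι = ⊥-elim (s≢ι s≡ι)
... | no _    = refl
adjFinal-≢init all D {s} s≢ι with s ≟ init D
... | yes s≡ι = ⊥-elim (s≢ι s≡ι)
... | no _    = refl
adjFinal-≢init allEx D _ = refl
adjFinal-≢init exAll D _ = refl

adjFinal-init-headNeutral : ∀ {n} Q (D : DFA n) →
  HeadNeutral (kindOf Q) (adjFinal Q D (init D) ≡ true)
adjFinal-init-headNeutral ex D with init D ≟ init D
... | yes _ = λ ()
... | no ι≢ι = ⊥-elim (ι≢ι refl)
adjFinal-init-headNeutral all D with init D ≟ init D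
... | yes _ = refl
... | no ι≢ι = ⊥-elim (ι≢ι refl)
adjFinal-init-headNeutral allEx D = tt
adjFinal-init-headNeutral exAll D = tt

runDFA∞ : ∀ {n} (D : DFA n) → Fin (size D) → InfTrace n → ℕ → Fin (size D)
runDFA∞ D q w zero    = q
runDFA∞ D q w (suc j) = δ D (runDFA∞ D q w j) (w j)

runDFA∞-unfold : ∀ {n} (D : DFA n) q w j →
  runDFA∞ D (δ D q (w 0)) (w ∘ suc) j ≡ runDFA∞ D q w (suc j)
runDFA∞-unfold D q w zero    = refl
runDFA∞-unfold D q w (suc j) = cong (λ s → δ D s (w (suc j))) (runDFA∞-unfold D q w j)

runDFA-tabulate : ∀ {n} (D : DFA n) q w m →
  runDFA D q (tabulate {n = m} (w ∘ toℕ)) ≡ runDFA∞ D q w m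
runDFA-tabulate D q w zero    = refl
runDFA-tabulate D q w (suc m) = begin
  runDFA D (δ D q (w 0)) (tabulate {n = m} ((w ∘ suc) ∘ toℕ)) ≡⟨ runDFA-tabulate D _ (w ∘ suc) m ⟩
  runDFA∞ D (δ D q (w 0)) (w ∘ suc) m                         ≡⟨ runDFA∞-unfold D q w m ⟩
  runDFA∞ D q w (suc m)                                       ∎
  where open ≡-Reasoning

runDTS-productDTS : ∀ {n k} (D : Fin k → DFA n) w j i →
  runDTS (productDTS D) w j i ≡ runDFA∞ (D i) (init (D i)) w j
runDTS-productDTS D w zero    i = refl
runDTS-productDTS D w (suc j) i = cong (λ s → δ (D i) s (w j)) (runDTS-productDTS D w j i)

label-suc⇔accepts : ∀ {n k} (q : Quant) (D : Fin k → DFA n) → (∀ i → NoIncoming (D i)) → ∀ w i j →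
  (adjFinal q (D i) (runDTS (productDTS D) w (suc j) i) ≡ true) ⇔ acceptsDFA (D i) (prefix w j)
label-suc⇔accepts q D noIncoming w i j = mk⇔ (subst (_≡ true) label≡) (subst (_≡ true) (sym label≡))
  where
  open ≡-Reasoning
  ι = init (D i)
  label≡ : adjFinal q (D i) (runDTS (productDTS D) w (suc j) i)
         ≡ final (D i) (runDFA (D i) ι (proj₂ (prefix w j)))
  label≡ = begin
    adjFinal q (D i) (runDTS (productDTS D) w (suc j) i)
      ≡⟨ adjFinal-≢init q (D i) (noIncoming i _ (w j)) ⟩
    final (D i) (runDTS (productDTS D) w (suc j) i)
      ≡⟨ cong (final (D i)) (runDTS-productDTS D w (suc j) i) ⟩
    final (D i) (runDFA∞ (D i) ι w (suc j))
      ≡⟨ cong (final (D i)) (sym (runDFA-tabulate (D i) ι w (suc j))) ⟩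
    final (D i) (runDFA (D i) ι (proj₂ (prefix w j))) ∎

proposition2 : ∀ {n k : ℕ} (L : Logic) (Ψ : PosBool (Fin k)) (Q : Fin k → Quant)
    (Φ : Fin k → Formula L n) (D : Fin k → DFA n) →
    (∀ i → Recognizes (D i) (Φ i)) → (∀ i → NoIncoming (D i)) →
    ∀ (w : InfTrace n) →
    (acceptsMP (A′ Ψ Q D) w → ⟦ Ψ ⟧⁺ Q Φ w) × (⟦ Ψ ⟧⁺ Q Φ w → acceptsMP (A′ Ψ Q D) w)
proposition2 L Ψ Q Φ D recognizes noIncoming w =
  Equivalence.to accepts⇔sem , Equivalence.from accepts⇔sem
  where
  labelled : Fin _ → ℕ → Set
  labelled i j = adjFinal (Q i) (D i) (runDTS (productDTS D) w j i) ≡ true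

  recognizes⇔ : ∀ i t → acceptsDFA (D i) t ⇔ (t ⊨ Φ i)
  recognizes⇔ i t = let to , from = recognizes i t in mk⇔ to from

  atom⇔ : ∀ i → holdsMP (kindOf (Q i)) (labelled i) ⇔ semQ (Q i) (_⊨ Φ i) w
  atom⇔ i = begin
    holdsMP κ (labelled i)
      ∼⟨ holdsMP-tail κ (labelled i) (adjFinal-init-headNeutral (Q i) (D i)) ⟩
    holdsMP κ (labelled i ∘ suc)
      ∼⟨ holdsMP-cong κ (λ j → ⇔.trans (label-suc⇔accepts (Q i) D noIncoming w i j)
                                        (recognizes⇔ i (prefix w j))) ⟩
    holdsMP κ ((_⊨ Φ i) ∘ prefix w)
      ∼⟨ ⇔.sym (semQ⇔holdsMP (Q i) (_⊨ Φ i) w) ⟩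
    semQ (Q i) (_⊨ Φ i) w ∎
    where
    open EquationalReasoning
    κ = kindOf (Q i)

  accepts⇔sem : acceptsMP (A′ Ψ Q D) w ⇔ ⟦ Ψ ⟧⁺ Q Φ w
  accepts⇔sem = evalPB-mapPB atom⇔ Ψ
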